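{- Let $\varphi$ be a $\mathbb{BST}$-conjunction, let $\psi$ be a conjunction of atoms of the form $x=\{y\}$, and let $M$ be a set assignment satisfying $\varphi\wedge\Xi^\psi_\varphi$. Define on the conjuncts of $\psi$ the relation $\ell \mathrel{\dot\prec^M} \ell'$, for $\ell$ being $x=\{y\}$ and $\ell'$ being $x'=\{y'\}$, to hold iff $Mx\cap My'\neq\emptyset$; and define $\ell\prec^M\ell'$ to hold iff there are conjuncts $\ell_0,\dots,\ell_n$ of $\psi$ with $n\geq 1$, $\ell=\ell_0$, $\ell_n=\ell'$ and $\ell_{i}\mathrel{\dot\prec^M}\ell_{i+1}$ for all $i<n$. Then $\prec^M$ is a strict partial order.
   Context: Set variables range over the von Neumann universe of well-founded sets. A $\mathbb{BST}$-conjunction is a conjunction of literals of the forms $u=v\setminus w$ and $u\neq v\setminus w$ (set variables $u,v,w$, ordinary set difference). $\mathrm{Vars}(\varphi\wedge\psi)$ denotes the set of variables occurring in $\varphi\wedge\psi$. For each $v\in\mathrm{Vars}(\varphi\wedge\psi)$ a new distinct auxiliary set variable $\tilde v$ is introduced. $\Xi^\psi_\varphi$ is the conjunction of: (i) $x\not\subseteq y$ for each conjunct $x=\{y\}$ of $\psi$; (ii) $(y=y'\leftrightarrow x=x')$ for each pair of conjuncts $x=\{y\}$, $x'=\{y'\}$ of $\psi$; (iii) $(x\cap v\neq\emptyset\to x\subseteq v)$ for each conjunct $x=\{y\}$ of $\psi$ and each $v\in\mathrm{Vars}(\varphi\wedge\psi)$; (iv) $(x\cap v\neq\emptyset\to\tilde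 y\subsetneq\tilde v)$ for each conjunct $x=\{y\}$ of $\psi$ and each $v\in\mathrm{Vars}(\varphi\wedge\psi)$; (v) $(x=y\to\tilde x=\tilde y)$ for all $x,y\in\mathrm{Vars}(\varphi\wedge\psi)$. A set assignment maps each variable to a well-founded set; satisfaction is the obvious one. -}

module Defs where

open import Data.Nat using (ℕ)
open import Data.Product using (Σ; _×_; _,_; proj₁; proj₂)
open import Data.Empty using (⊥; ⊥-elim)
open import Data.List using (List; []; _∷_; _++_; concatMap)
open import Data.List.Membership.Propositional using (_∈_)
open import Relation.Nullary using (¬_)
open import Relation.Binary.PropositionalEquality using (_≡_)
open import Relation.Binary.Construct.Closure.Transitive using (TransClosure)

-- The von Neumann universe of well-founded sets, rendered as Aczel's
-- type-theoretic model of iterative (hence well-founded) sets, with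
-- extensional (bisimulation) equality.

data V : Set₁ where
  sup : (A : Set) → (A → V) → V

infix 4 _≐_ _∈V_ _⊆_ _⊊_

_≐_ : V → V → Set
sup A f ≐ sup B g =
  ((a : A) → Σ B λ b → f a ≐ g b) × ((b : B) → Σ A λ a → f a ≐ g b)

_∈V_ : V → V → Set
x ∈V sup A f = Σ A λ a → x ≐ f a

_⊆_ : V → V → Set
sup A f ⊆ y = (a : A) → f a ∈V y

_⊊_ : V → V → Set
x ⊊ y = (x ⊆ y) × ¬ (x ≐ y)

∅ : V
∅ = sup ⊥ ⊥-elim

_∖_ : V → V → V
sup A f ∖ w = sup (Σ A λ a → ¬ (f a ∈V w)) (λ p → f (proj₁ p))

_∩_ : V → V → V
sup A f ∩ w = sup (Σ A λ a → f a ∈V w) (λ p → f (proj₁ p))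

Var : Set
Var = ℕ

data Lit : Set where
  eqDiff  : Var → Var → Var → Lit
  neqDiff : Var → Var → Var → Lit

BST : Set
BST = List Lit

-- a conjunction of atoms x = {y}: list of pairs (x , y)
Sing : Set
Sing = List (Var × Var)

litVars : Lit → List Var
litVars (eqDiff u v w)  = u ∷ v ∷ w ∷ []
litVars (neqDiff u v w) = u ∷ v ∷ w ∷ []

singVars : Var × Var → List Var
singVars (x , y) = x ∷ y ∷ []

Vars : BST → Sing → List Var
Vars φ ψ = concatMap litVars φ ++ concatMap singVars ψ

-- Semantics.  A set assignment M : Var → V; the auxiliary variables ṽ
-- (new and distinct from everything in Vars(φ∧ψ)) are assigned by Mt,
-- i.e. Mt v is the value of ṽ.

Assignment : Set₁
Assignment = Var → V

SatLit : Assignment → Lit → Set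
SatLit M (eqDiff u v w)  = M u ≐ (M v ∖ M w)
SatLit M (neqDiff u v w) = ¬ (M u ≐ (M v ∖ M w))

SatBST : Assignment → BST → Set
SatBST M φ = (l : Lit) → l ∈ φ → SatLit M l

record SatΞ (M Mt : Assignment) (φ : BST) (ψ : Sing) : Set where
  field
    clause-i   : (x y : Var) → (x , y) ∈ ψ → ¬ (M x ⊆ M y)
    clause-ii  : (x y x' y' : Var) → (x , y) ∈ ψ → (x' , y') ∈ ψ →
                 ((M y ≐ M y' → M x ≐ M x') × (M x ≐ M x' → M y ≐ M y'))
    clause-iii : (x y v : Var) → (x , y) ∈ ψ → v ∈ Vars φ ψ →
                 ¬ ((M x ∩ M v) ≐ ∅) → M x ⊆ M v
    clause-iv  : (x y v : Var) → (x , y) ∈ ψ → v ∈ Vars φ ψ →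
                 ¬ ((M x ∩ M v) ≐ ∅) → Mt y ⊊ Mt v
    clause-v   : (x y : Var) → x ∈ Vars φ ψ → y ∈ Vars φ ψ →
                 M x ≐ M y → Mt x ≐ Mt y

Conj : Sing → Set
Conj ψ = Σ (Var × Var) λ ℓ → ℓ ∈ ψ

_≈C_ : {ψ : Sing} → Conj ψ → Conj ψ → Set
ℓ ≈C ℓ' = proj₁ ℓ ≡ proj₁ ℓ'

≺̇ : (M : Assignment) (ψ : Sing) → Conj ψ → Conj ψ → Set
≺̇ M ψ ((x , y) , _) ((x' , y') , _) = ¬ ((M x ∩ M y') ≐ ∅)

≺ : (M : Assignment) (ψ : Sing) → Conj ψ → Conj ψ → Set
≺ M ψ = TransClosure (≺̇ M ψ)

-- Clause (iv) of Ξ makes y ↦ M̃y a rank on the conjuncts x = {y} of ψ: if Mx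
-- meets My' then M̃y ⊊ M̃y'.  So every ≺-chain is a ⊊-chain of ranks, and ≺ is
-- irreflexive because ⊊ is.  Transitivity is free for a transitive closure,
-- and ≺̇ depends only on the atoms of its arguments.
module Submission where

open import Defs
open import Data.Product using (_,_; proj₁)
open import Data.List using (concatMap)
open import Data.List.Membership.Propositional using (_∈_)
open import Data.List.Membership.Propositional.Properties using (∈-++⁺ʳ; ∈-concatMap⁺)
open import Data.List.Relation.Unary.Any as Any using (here; there)
open import Function.Base using (_on_)
open import Level using (Level)
open import Relation.Nullary using (¬_)
open import Relation.Binary.Core using (Rel; _⇒_)
open import Relation.Binary.Definitions using (Transitive; Irreflexive; _Respects₂_)
open import Relation.Binary.Structures using (IsStrictPartialOrder)
open import Relation.Binary.PropositionalEquality as ≡ using (refl)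
import Relation.Binary.Construct.On as On
open import Relation.Binary.Construct.Closure.Transitive using (TransClosure; [_]; _∷_; _++_)

≐-refl : (x : V) → x ≐ x
≐-refl (sup A f) = (λ a → a , ≐-refl (f a)) , (λ a → a , ≐-refl (f a))

≐-sym : (x y : V) → x ≐ y → y ≐ x
≐-sym (sup A f) (sup B g) (f⊑g , g⊑f) =
  (λ b → let a , fa≐gb = g⊑f b in a , ≐-sym (f a) (g b) fa≐gb) ,
  (λ a → let b , fa≐gb = f⊑g a in b , ≐-sym (f a) (g b) fa≐gb)

≐-trans : (x y z : V) → x ≐ y → y ≐ z → x ≐ z
≐-trans (sup A f) (sup B g) (sup C h) (f⊑g , g⊑f) (g⊑h , h⊑g) =
  (λ a → let b , fa≐gb = f⊑g a ; c , gb≐hc = g⊑h b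
         in c , ≐-trans (f a) (g b) (h c) fa≐gb gb≐hc) ,
  (λ c → let b , gb≐hc = h⊑g c ; a , fa≐gb = g⊑f b
         in a , ≐-trans (f a) (g b) (h c) fa≐gb gb≐hc)

≐⇒⊆ : (x y : V) → x ≐ y → x ⊆ y
≐⇒⊆ (sup A f) (sup B g) (f⊑g , _) = f⊑g

⊆-trans : (x y z : V) → x ⊆ y → y ⊆ z → x ⊆ z
⊆-trans (sup A f) (sup B g) (sup C h) x⊆y y⊆z a =
  let b , fa≐gb = x⊆y a ; c , gb≐hc = y⊆z b
  in c , ≐-trans (f a) (g b) (h c) fa≐gb gb≐hc

⊆-antisym : (x y : V) → x ⊆ y → y ⊆ x → x ≐ y
⊆-antisym (sup A f) (sup B g) x⊆y y⊆x =
  x⊆y , (λ b → let a , gb≐fa = y⊆x b in a , ≐-sym (g b) (f a) gb≐fa)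

⊊-irrefl : (x : V) → ¬ (x ⊊ x)
⊊-irrefl x (_ , x≉x) = x≉x (≐-refl x)

⊊-trans : (x y z : V) → x ⊊ y → y ⊊ z → x ⊊ z
⊊-trans x y z (x⊆y , x≉y) (y⊆z , _) = x⊆z , x≉z
  where
  x⊆z = ⊆-trans x y z x⊆y y⊆z
  x≉z : ¬ (x ≐ z)
  x≉z x≐z = x≉y (⊆-antisym x y x⊆y
                   (⊆-trans y z x y⊆z (≐⇒⊆ z x (≐-sym x z x≐z))))

module _ {a ℓ₁ ℓ₂ : Level} {A : Set a} {R : Rel A ℓ₁} where

  transClosure-least : {S : Rel A ℓ₂} → Transitive S → R ⇒ S → TransClosure R ⇒ S
  transClosure-least trans R⇒S [ xRy ]        = R⇒S xRy
  transClosure-least trans R⇒S (xRy ∷ yR⁺z) =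
    trans (R⇒S xRy) (transClosure-least trans R⇒S yR⁺z)

  transClosure-respects₂ : {_≈_ : Rel A ℓ₂} → R Respects₂ _≈_ → TransClosure R Respects₂ _≈_
  transClosure-respects₂ {_≈_} (respʳ , respˡ) = resp⁺ʳ , resp⁺ˡ
    where
    resp⁺ʳ : ∀ {x y z} → y ≈ z → TransClosure R x y → TransClosure R x z
    resp⁺ʳ y≈z [ xRy ]        = [ respʳ y≈z xRy ]
    resp⁺ʳ y≈z (xRw ∷ wR⁺y) = xRw ∷ resp⁺ʳ y≈z wR⁺y

    resp⁺ˡ : ∀ {x y z} → x ≈ y → TransClosure R x z → TransClosure R y z
    resp⁺ˡ x≈y [ xRz ]        = [ respˡ x≈y xRz ]
    resp⁺ˡ x≈y (xRw ∷ wR⁺z) = respˡ x≈y xRw ∷ wR⁺z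

singleton∈Vars : (φ : BST) {ψ : Sing} {x y : Var} → (x , y) ∈ ψ → y ∈ Vars φ ψ
singleton∈Vars φ x,y∈ψ =
  ∈-++⁺ʳ (concatMap litVars φ)
         (∈-concatMap⁺ singVars (Any.map (λ { refl → there (here refl) }) x,y∈ψ))

≺̇-resp-≈C : (M : Assignment) (ψ : Sing) → ≺̇ M ψ Respects₂ _≈C_
≺̇-resp-≈C M ψ = (λ { refl ℓ≺̇ℓ' → ℓ≺̇ℓ' }) , (λ { refl ℓ≺̇ℓ' → ℓ≺̇ℓ' })

module _ (φ : BST) (ψ : Sing) (M Mt : Assignment) (Ξ : SatΞ M Mt φ ψ) where
  open SatΞ Ξ

  rank : Conj ψ → V
  rank ((_ , y) , _) = Mt y

  ≺̇⇒⊊ : ≺̇ M ψ ⇒ (_⊊_ on rank)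
  ≺̇⇒⊊ {(x , y) , x,y∈ψ} {(_ , y') , x',y'∈ψ} =
    clause-iv x y y' x,y∈ψ (singleton∈Vars φ x',y'∈ψ)

  ≺⇒⊊ : ≺ M ψ ⇒ (_⊊_ on rank)
  ≺⇒⊊ = transClosure-least (λ {ℓ} {ℓ'} {ℓ''} → ⊊-trans (rank ℓ) (rank ℓ') (rank ℓ''))
                            (λ {ℓ} {ℓ'} → ≺̇⇒⊊ {ℓ} {ℓ'})

  ≺-irrefl : Irreflexive _≈C_ (≺ M ψ)
  ≺-irrefl {ℓ} refl ℓ≺ℓ = ⊊-irrefl (rank ℓ) (≺⇒⊊ ℓ≺ℓ)

lemma5 : (φ : BST) (ψ : Sing) (M Mt : Assignment) →
         SatBST M φ → SatΞ M Mt φ ψ →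
         IsStrictPartialOrder (_≈C_ {ψ}) (≺ M ψ)
lemma5 φ ψ M Mt _ Ξ = record
  { isEquivalence = On.isEquivalence proj₁ ≡.isEquivalence
  ; irrefl        = ≺-irrefl φ ψ M Mt Ξ
  ; trans         = _++_
  ; <-resp-≈      = transClosure-respects₂ (≺̇-resp-≈C M ψ)
  }
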